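{- Let $r\ge 3$ and let $k_0,k_1,\dots,k_{r-1}$ be integers with $3\le k_0\le k_1\le \cdots \le k_{r-1}$. Then for every integer $m$ with $2\le m\le r-1$, \[ S(r;k_0,\dots,k_{r-1}) \ge \Bigl(\prod_{j=m}^{r-1}k_j\Bigr)\,S(m;k_0,\dots,k_{m-1}) -\sum_{i=m}^{r-1}\prod_{j=i+1}^{r-1}k_j, \] where an empty product is interpreted as $1$.
   Context: For an integer $k\ge 3$, let $\mathcal{L}(k)$ denote the linear equation $x_1+x_2+\cdots+x_{k-1}=x_k$ in positive integer variables. For integers $r\ge 1$ and $k_0,\dots,k_{r-1}\ge 3$, the generalized Schur number $S(r;k_0,\dots,k_{r-1})$ is the least positive integer $N$ such that for every coloring of $[1,N]=\{1,2,\dots,N\}$ with the $r$ colors $0,1,\dots,r-1$, there is some $i\in\{0,\dots,r-1\}$ and a solution $(x_1,\dots,x_{k_i})$ of $\mathcal{L}(k_i)$ with all $x_j\in[1,N]$ colored $i$. -}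

module Defs where

open import Data.Nat using (ℕ; zero; suc; _+_; _*_; _∸_; _≤_; _<_)
open import Relation.Binary.PropositionalEquality using (_≡_)
open import Data.Fin using (Fin; toℕ; inject₁; fromℕ)
open import Data.Product using (Σ; ∃; _×_; _,_)

sumFin : (n : ℕ) → (Fin n → ℕ) → ℕ
sumFin zero f = 0
sumFin (suc n) f = f Data.Fin.zero + sumFin n (λ i → f (Data.Fin.suc i))

-- The variables x_1..x_{k-1} are
-- xs : Fin (k ∸ 1) → ℕ and x_k is xk.  (k ≥ 3 always, so k ∸ 1 = k - 1.)
MonoSol : (r : ℕ) → (c : ℕ → Fin r) → (N : ℕ) → (i : Fin r) → (k : ℕ) → Set
MonoSol r c N i k =
  Σ (Fin (k ∸ 1) → ℕ) λ xs → Σ ℕ λ xk →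
    ((j : Fin (k ∸ 1)) → (1 ≤ xs j) × (xs j ≤ N) × (c (xs j) ≡ i))
    × (1 ≤ xk) × (xk ≤ N) × (c xk ≡ i)
    × (sumFin (k ∸ 1) xs ≡ xk)

-- Every r-coloring of [1,N] has, for some color i, a solution of L(k_i)
-- with all entries in [1,N] colored i.  (Colorings are given as functions
-- ℕ → Fin r; only their values on [1,N] are relevant.)
SchurProperty : (r : ℕ) → (ks : Fin r → ℕ) → (N : ℕ) → Set
SchurProperty r ks N =
  (c : ℕ → Fin r) → ∃ λ (i : Fin r) → MonoSol r c N i (ks i)

IsSchurNumber : (r : ℕ) → (ks : Fin r → ℕ) → (N : ℕ) → Set
IsSchurNumber r ks N =
  (1 ≤ N) × SchurProperty r ks N
  × ((M : ℕ) → 1 ≤ M → SchurProperty r ks M → N ≤ M)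

prodFrom : (r : ℕ) → (ks : Fin r → ℕ) → ℕ → ℕ
prodFrom zero ks m = 1
prodFrom (suc r) ks zero = ks Data.Fin.zero * prodFrom r (λ j → ks (Data.Fin.suc j)) zero
prodFrom (suc r) ks (suc m) = prodFrom r (λ j → ks (Data.Fin.suc j)) m

sumRange : ℕ → ℕ → (ℕ → ℕ) → ℕ
sumRange a b f = go (b ∸ a) a
  where
  go : ℕ → ℕ → ℕ
  go zero i = 0
  go (suc n) i = f i + go n (suc i)

restrict : {r : ℕ} → (m : ℕ) → m ≤ r → (Fin r → ℕ) → (Fin m → ℕ)
restrict m m≤r ks j = ks (Data.Fin.inject≤ j m≤r)

-- Let c color [1, N] with n colors so that no color i has a monochromatic solution of
-- L(k_i), and let k = 2 + K ≥ every k_i.  With B = K(N+1) + N = (k-1)(N+1) - 1, color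
-- [1, B+N] by c on [1, N], by a new color on (N, B], and by x ↦ c (x - B) on (B, B+N].
-- A solution of L(k) in the new color has sum ≥ (k-1)(N+1) > B.  A solution of L(k_i)
-- in an old color lies in [1, N]; or has x_k and some summand above B, and subtracting B
-- from both gives a solution in [1, N]; or has all summands ≤ N, so x_k ≤ (k-1)N ≤ B,
-- which forces x_k ≤ N.  Hence S(n+1; …, k) ≥ k S(n; …) - 1, and iterating from m to r
-- colors gives the bound.  Constructively we prove the contrapositive: the Schur
-- property for n+1 colors at B + N implies it for n colors at N.
module Submission where

open import Defs
open import Data.Nat using (ℕ; zero; suc; _+_; _*_; _∸_; _≤_; _<_; z≤n; s≤s; s≤s⁻¹; _≤?_; _<?_)
open import Data.Nat.Properties
open import Data.Nat.Tactic.RingSolver using (solve-∀)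
open import Data.Fin using (Fin; toℕ; inject₁; fromℕ; fromℕ<; inject≤)
open import Data.Fin.Properties
  using ( any?; toℕ<n; toℕ-injective; toℕ-inject₁; toℕ-inject≤; toℕ-fromℕ; toℕ-fromℕ<
        ; inject≤-refl; inject₁-injective; fromℕ≢inject₁)
  renaming (_≟_ to _≟ᶠ_)
open import Data.Fin.Relation.Unary.Top using (view; ‵fromℕ; ‵inj₁)
open import Data.Vec.Functional using (init; last; updateAt)
open import Data.Vec.Functional.Properties using (updateAt-updates; updateAt-minimal)
open import Data.Product using (∃; _×_; _,_; proj₁; proj₂)
open import Data.Empty using (⊥-elim)
open import Relation.Nullary using (¬_; Dec; yes; no)
open import Relation.Nullary.Decidable using (decidable-stable)
open import Relation.Binary.PropositionalEquality

term≤sumFin : ∀ {d} (f : Fin d → ℕ) j → f j ≤ sumFin d f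
term≤sumFin f Fin.zero = m≤m+n _ _
term≤sumFin f (Fin.suc j) = ≤-trans (term≤sumFin (λ i → f (Fin.suc i)) j) (m≤n+m _ _)

sumFin-lowerBound : ∀ {d} (f : Fin d → ℕ) {a} → (∀ j → a ≤ f j) → d * a ≤ sumFin d f
sumFin-lowerBound {zero} f a≤f = z≤n
sumFin-lowerBound {suc d} f a≤f =
  +-mono-≤ (a≤f Fin.zero) (sumFin-lowerBound (λ i → f (Fin.suc i)) (λ j → a≤f (Fin.suc j)))

sumFin-upperBound : ∀ {d} (f : Fin d → ℕ) {a} → (∀ j → f j ≤ a) → sumFin d f ≤ d * a
sumFin-upperBound {zero} f f≤a = z≤n
sumFin-upperBound {suc d} f f≤a =
  +-mono-≤ (f≤a Fin.zero) (sumFin-upperBound (λ i → f (Fin.suc i)) (λ j → f≤a (Fin.suc j)))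

sumFin-updateAt : ∀ {d} (f : Fin d → ℕ) j (g : ℕ → ℕ) →
                  sumFin d (updateAt f j g) + f j ≡ sumFin d f + g (f j)
sumFin-updateAt {suc d} f Fin.zero g =
  swap (g (f Fin.zero)) (sumFin d (λ i → f (Fin.suc i))) (f Fin.zero)
  where
  swap : ∀ a b c → a + b + c ≡ c + b + a
  swap = solve-∀
sumFin-updateAt {suc d} f (Fin.suc j) g = begin
  f Fin.zero + sumFin d (updateAt f′ j g) + f′ j   ≡⟨ +-assoc (f Fin.zero) _ _ ⟩
  f Fin.zero + (sumFin d (updateAt f′ j g) + f′ j) ≡⟨ cong (f Fin.zero +_) (sumFin-updateAt f′ j g) ⟩
  f Fin.zero + (sumFin d f′ + g (f′ j))            ≡⟨ +-assoc (f Fin.zero) _ _ ⟨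
  f Fin.zero + sumFin d f′ + g (f′ j)              ∎
  where
  open ≡-Reasoning
  f′ : Fin d → ℕ
  f′ i = f (Fin.suc i)

sumRange-step : ∀ {a b} (f : ℕ → ℕ) → a < b → sumRange a b f ≡ f a + sumRange (suc a) b f
sumRange-step {a} {suc b} f (s≤s a≤b) rewrite +-∸-assoc 1 a≤b = refl

sumRange-empty : ∀ a (f : ℕ → ℕ) → sumRange a a f ≡ 0
sumRange-empty a f rewrite n∸n≡0 a = refl

prodFrom-step : ∀ {r m} (ks : Fin r → ℕ) (m<r : m < r) →
                prodFrom r ks m ≡ ks (fromℕ< m<r) * prodFrom r ks (suc m)
prodFrom-step {suc r} {zero} ks _ = refl
prodFrom-step {suc r} {suc m} ks (s≤s m<r) = prodFrom-step (λ j → ks (Fin.suc j)) m<r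

prodFrom-empty : ∀ {r m} (ks : Fin r → ℕ) → r ≤ m → prodFrom r ks m ≡ 1
prodFrom-empty {zero} ks _ = refl
prodFrom-empty {suc r} {suc m} ks (s≤s r≤m) = prodFrom-empty (λ j → ks (Fin.suc j)) r≤m

MonoSol-mono : ∀ {r c N N′ i k} → N ≤ N′ → MonoSol r c N i k → MonoSol r c N′ i k
MonoSol-mono N≤N′ (xs , xk , hxs , 1≤xk , xk≤N , cxk , Σ≡xk) =
  xs , xk , (λ j → let (1≤x , x≤N , cx) = hxs j in 1≤x , ≤-trans x≤N N≤N′ , cx) ,
  1≤xk , ≤-trans xk≤N N≤N′ , cxk , Σ≡xk

SchurProperty-mono : ∀ {r ks N N′} → N ≤ N′ → SchurProperty r ks N → SchurProperty r ks N′
SchurProperty-mono {ks = ks} N≤N′ schur c with schur c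
... | i , sol = i , MonoSol-mono {k = ks i} N≤N′ sol

SchurProperty-cong : ∀ {r ks ks′ N} → (∀ i → ks i ≡ ks′ i) →
                     SchurProperty r ks N → SchurProperty r ks′ N
SchurProperty-cong {r} {N = N} ks≗ks′ schur c with schur c
... | i , sol = i , subst (MonoSol r c N i) (ks≗ks′ i) sol

IsSchurNumber⇒¬SchurProperty-pred : ∀ {r ks N} → 0 < r →
                                    IsSchurNumber r ks (suc N) → ¬ SchurProperty r ks N
IsSchurNumber⇒¬SchurProperty-pred {N = zero} 0<r _ schur with schur (λ _ → fromℕ< 0<r)
... | _ , (_ , _ , _ , 1≤xk , xk≤0 , _) = <⇒≱ 1≤xk xk≤0
IsSchurNumber⇒¬SchurProperty-pred {N = suc N} _ (_ , _ , minimal) schur =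
  1+n≰n (minimal (suc N) (s≤s z≤n) schur)

module Extension {n} (c : ℕ → Fin n) (N K : ℕ) where

  B : ℕ
  B = K * suc N + N

  N≤B : N ≤ B
  N≤B = m≤n+m N (K * suc N)

  coloring : ℕ → Fin (suc n)
  coloring x with x ≤? N | x ≤? B
  ... | yes _ | _     = inject₁ (c x)
  ... | no _  | yes _ = fromℕ n
  ... | no _  | no _  = inject₁ (c (x ∸ B))

  coloring-new : ∀ {x} → coloring x ≡ fromℕ n → N < x × x ≤ B
  coloring-new {x} e with x ≤? N | x ≤? B
  ... | yes _   | _       = ⊥-elim (fromℕ≢inject₁ (sym e))
  ... | no x≰N  | yes x≤B = ≰⇒> x≰N , x≤B
  ... | no _    | no _    = ⊥-elim (fromℕ≢inject₁ (sym e))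

  coloring-low : ∀ {x i} → x ≤ N → coloring x ≡ inject₁ i → c x ≡ i
  coloring-low {x} x≤N e with x ≤? N | x ≤? B
  ... | yes _   | _ = inject₁-injective e
  ... | no x≰N  | _ = ⊥-elim (x≰N x≤N)

  coloring-high : ∀ {x i} → B < x → coloring x ≡ inject₁ i → c (x ∸ B) ≡ i
  coloring-high {x} B<x e with x ≤? N | x ≤? B
  ... | yes x≤N | _       = ⊥-elim (<⇒≱ B<x (≤-trans x≤N N≤B))
  ... | no _    | yes x≤B = ⊥-elim (<⇒≱ B<x x≤B)
  ... | no _    | no _    = inject₁-injective e

  coloring-mid : ∀ {x i} → coloring x ≡ inject₁ i → x ≤ B → x ≤ N
  coloring-mid {x} e x≤B with x ≤? N | x ≤? B
  ... | yes x≤N | _       = x≤N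
  ... | no _    | yes _   = ⊥-elim (fromℕ≢inject₁ e)
  ... | no _    | no x≰B  = ⊥-elim (x≰B x≤B)

  no-new-solution : ∀ {M} → ¬ MonoSol (suc n) coloring M (fromℕ n) (2 + K)
  no-new-solution (xs , xk , hxs , _ , _ , cxk , Σ≡xk) = 1+n≰n (+-cancelˡ-≤ (K * suc N) _ _ (begin
    K * suc N + suc N    ≡⟨ +-comm (K * suc N) (suc N) ⟩
    suc K * suc N        ≤⟨ sumFin-lowerBound xs (λ j → proj₁ (coloring-new (proj₂ (proj₂ (hxs j))))) ⟩
    sumFin (suc K) xs    ≡⟨ Σ≡xk ⟩
    xk                   ≤⟨ proj₂ (coloring-new cxk) ⟩
    K * suc N + N        ∎))
    where
    open ≤-Reasoning

  solution-below : ∀ {k i} (sol : MonoSol (suc n) coloring (B + N) (inject₁ i) k) →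
                   proj₁ (proj₂ sol) ≤ N → MonoSol n c N i k
  solution-below (xs , xk , hxs , 1≤xk , _ , cxk , Σ≡xk) xk≤N =
    xs , xk , (λ j → let (1≤x , _ , cx) = hxs j in 1≤x , xs≤N j , coloring-low (xs≤N j) cx) ,
    1≤xk , xk≤N , coloring-low xk≤N cxk , Σ≡xk
    where
    xs≤N : ∀ j → xs j ≤ N
    xs≤N j = ≤-trans (term≤sumFin xs j) (≤-trans (≤-reflexive Σ≡xk) xk≤N)

  solution-shift : ∀ {k i} (sol : MonoSol (suc n) coloring (B + N) (inject₁ i) k) →
                   ∃ (λ j → B < proj₁ sol j) → MonoSol n c N i k
  solution-shift {k} {i} (xs , xk , hxs , _ , xk≤M , cxk , Σ≡xk) (j₀ , B<x₀) =
    xs′ , xk ∸ B , hxs′ , m<n⇒0<n∸m B<xk , xk′≤N , coloring-high B<xk cxk , Σxs′≡xk′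
    where
    xs′ : Fin (k ∸ 1) → ℕ
    xs′ = updateAt xs j₀ (_∸ B)

    B<xk : B < xk
    B<xk = <-≤-trans B<x₀ (≤-trans (term≤sumFin xs j₀) (≤-reflexive Σ≡xk))

    xk′≤N : xk ∸ B ≤ N
    xk′≤N = m≤n+o⇒m∸n≤o xk B xk≤M

    Σxs′≡xk′ : sumFin (k ∸ 1) xs′ ≡ xk ∸ B
    Σxs′≡xk′ = +-cancelʳ-≡ (xs j₀) _ _ (begin
      sumFin (k ∸ 1) xs′ + xs j₀      ≡⟨ sumFin-updateAt xs j₀ (_∸ B) ⟩
      sumFin (k ∸ 1) xs + (xs j₀ ∸ B) ≡⟨ cong (_+ (xs j₀ ∸ B)) Σ≡xk ⟩
      xk + (xs j₀ ∸ B)                ≡⟨ +-∸-assoc xk (<⇒≤ B<x₀) ⟨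
      xk + xs j₀ ∸ B                  ≡⟨ +-∸-comm (xs j₀) (<⇒≤ B<xk) ⟩
      xk ∸ B + xs j₀                  ∎)
      where open ≡-Reasoning

    xs′≤N : ∀ j → xs′ j ≤ N
    xs′≤N j = ≤-trans (term≤sumFin xs′ j) (≤-trans (≤-reflexive Σxs′≡xk′) xk′≤N)

    entry : ∀ j → (1 ≤ xs′ j) × (c (xs′ j) ≡ i)
    entry j with j ≟ᶠ j₀
    ... | yes refl = subst (λ y → (1 ≤ y) × (c y ≡ i)) (sym (updateAt-updates j₀ xs))
      (m<n⇒0<n∸m B<x₀ , coloring-high B<x₀ (proj₂ (proj₂ (hxs j₀))))
    ... | no j≢j₀ = subst (λ y → (1 ≤ y) × (c y ≡ i)) (sym unchanged)
      (proj₁ (hxs j) , coloring-low (subst (_≤ N) unchanged (xs′≤N j)) (proj₂ (proj₂ (hxs j))))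
      where
      unchanged : xs′ j ≡ xs j
      unchanged = updateAt-minimal j j₀ xs j≢j₀

    hxs′ : ∀ j → (1 ≤ xs′ j) × (xs′ j ≤ N) × (c (xs′ j) ≡ i)
    hxs′ j = proj₁ (entry j) , xs′≤N j , proj₂ (entry j)

  old-solution : ∀ {k i} → k ≤ 2 + K →
                 MonoSol (suc n) coloring (B + N) (inject₁ i) k → MonoSol n c N i k
  old-solution {k} {i} k≤ sol@(xs , xk , hxs , _ , _ , cxk , Σ≡xk) =
    cases (xk ≤? N) (any? (λ j → B <? xs j))
    where
    cases : Dec (xk ≤ N) → Dec (∃ λ j → B < xs j) → MonoSol n c N i k
    cases (yes xk≤N) _         = solution-below {k} sol xk≤N
    cases (no _)     (yes big) = solution-shift {k} sol big
    cases (no xk≰N)  (no ¬big) = ⊥-elim (xk≰N (coloring-mid cxk xk≤B))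
      where
      open ≤-Reasoning
      xs≤N : ∀ j → xs j ≤ N
      xs≤N j = coloring-mid (proj₂ (proj₂ (hxs j))) (≮⇒≥ (λ B<x → ¬big (j , B<x)))
      xk≤B : xk ≤ B
      xk≤B = begin
        xk                 ≡⟨ Σ≡xk ⟨
        sumFin (k ∸ 1) xs  ≤⟨ sumFin-upperBound xs xs≤N ⟩
        (k ∸ 1) * N        ≤⟨ *-monoˡ-≤ N (∸-monoˡ-≤ 1 k≤) ⟩
        N + K * N          ≤⟨ +-monoʳ-≤ N (*-monoʳ-≤ K (n≤1+n N)) ⟩
        N + K * suc N      ≡⟨ +-comm N (K * suc N) ⟩
        B                  ∎

SchurProperty-init : ∀ {n} (ks : Fin (suc n) → ℕ) K N →
                     last ks ≡ 2 + K → (∀ i → init ks i ≤ 2 + K) →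
                     SchurProperty (suc n) ks (K * suc N + N + N) → SchurProperty n (init ks) N
SchurProperty-init {n} ks K N last≡ init≤ schur c with schur (Extension.coloring c N K)
... | i , sol = restrict-color i sol
  where
  open Extension c N K
  restrict-color : ∀ i → MonoSol (suc n) coloring (B + N) i (ks i) →
                   ∃ λ i′ → MonoSol n c N i′ (init ks i′)
  restrict-color i sol with view i
  ... | ‵fromℕ = ⊥-elim (no-new-solution (subst (MonoSol (suc n) coloring (B + N) (fromℕ n)) last≡ sol))
  ... | ‵inj₁ {i = i′} _ = i′ , old-solution (init≤ i′) sol

bound-step : ∀ K q L R N → suc L + (q + R) ≤ (2 + K) * q * suc N →
             suc L + R ≤ q * suc (K * suc N + N + N)
bound-step K q L R N bound = +-cancelʳ-≤ q _ _ (begin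
  suc L + R + q                   ≡⟨ +-assoc (suc L) R q ⟩
  suc L + (R + q)                 ≡⟨ cong (suc L +_) (+-comm R q) ⟩
  suc L + (q + R)                 ≤⟨ bound ⟩
  (2 + K) * q * suc N             ≡⟨ identity K q N ⟩
  q * suc (K * suc N + N + N) + q ∎)
  where
  open ≤-Reasoning
  identity : ∀ K q N → (2 + K) * q * suc N ≡ q * suc (K * suc N + N + N) + q
  identity = solve-∀

module Descent {r} (ks : Fin r → ℕ) (ks≥2 : ∀ i → 2 ≤ ks i)
               (ks-mono : ∀ i j → toℕ i ≤ toℕ j → ks i ≤ ks j) where

  tailSum : ℕ → ℕ
  tailSum m = sumRange m r (λ i → prodFrom r ks (suc i))

  restrict-refl : (r≤r : r ≤ r) → ∀ i → restrict r r≤r ks i ≡ ks i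
  restrict-refl r≤r i = cong ks (inject≤-refl i r≤r)

  restrict-init : ∀ {m} (p : suc m ≤ r) (q : m ≤ r) i →
                  init (restrict (suc m) p ks) i ≡ restrict m q ks i
  restrict-init p q i = cong ks (toℕ-injective (begin
    toℕ (inject≤ (inject₁ i) p) ≡⟨ toℕ-inject≤ (inject₁ i) p ⟩
    toℕ (inject₁ i)             ≡⟨ toℕ-inject₁ i ⟩
    toℕ i                       ≡⟨ toℕ-inject≤ i q ⟨
    toℕ (inject≤ i q)           ∎))
    where open ≡-Reasoning

  restrict-last : ∀ {m} (p : suc m ≤ r) → last (restrict (suc m) p ks) ≡ ks (fromℕ< p)
  restrict-last {m} p = cong ks (toℕ-injective (begin
    toℕ (inject≤ (fromℕ m) p) ≡⟨ toℕ-inject≤ (fromℕ m) p ⟩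
    toℕ (fromℕ m)             ≡⟨ toℕ-fromℕ m ⟩
    m                         ≡⟨ toℕ-fromℕ< p ⟨
    toℕ (fromℕ< p)            ∎))
    where open ≡-Reasoning

  restrict-init≤last : ∀ {m} (p : suc m ≤ r) i →
                       init (restrict (suc m) p ks) i ≤ last (restrict (suc m) p ks)
  restrict-init≤last {m} p i = ks-mono _ _ (subst₂ _≤_
    (sym (trans (toℕ-inject≤ (inject₁ i) p) (toℕ-inject₁ i)))
    (sym (trans (toℕ-inject≤ (fromℕ m) p) (toℕ-fromℕ m)))
    (<⇒≤ (toℕ<n i)))

  -- The bound says that L is at most the result of applying N ↦ k_j(N+1) - 2 to N
  -- successively for j = m, …, r-1.
  SchurProperty-restrict : ∀ d m → d + m ≡ r → (m≤r : m ≤ r) → ∀ N L →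
                           suc L + tailSum m ≤ prodFrom r ks m * suc N →
                           SchurProperty r ks L → SchurProperty m (restrict m m≤r ks) N
  SchurProperty-restrict zero m refl r≤r N L bound schur =
    SchurProperty-cong (λ i → sym (restrict-refl r≤r i)) (SchurProperty-mono {ks = ks} (s≤s⁻¹ L<N+1) schur)
    where
    open ≤-Reasoning
    L<N+1 : suc L ≤ suc N
    L<N+1 = begin
      suc L                   ≡⟨ +-identityʳ (suc L) ⟨
      suc L + 0               ≡⟨ cong (suc L +_) (sumRange-empty r _) ⟨
      suc L + tailSum r       ≤⟨ bound ⟩
      prodFrom r ks r * suc N ≡⟨ cong (_* suc N) (prodFrom-empty ks ≤-refl) ⟩
      1 * suc N               ≡⟨ *-identityˡ (suc N) ⟩
      suc N                   ∎
  SchurProperty-restrict (suc d) m eq m≤r N L bound schur =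
    SchurProperty-cong {ks = init (restrict (suc m) p ks)} (restrict-init p m≤r)
      (SchurProperty-init (restrict (suc m) p ks) K N last≡ init≤
        (SchurProperty-restrict d (suc m) (trans (+-suc d m) eq) p (K * suc N + N + N) L
          (bound-step K q L (tailSum (suc m)) N bound′) schur))
    where
    p : suc m ≤ r
    p = subst (suc m ≤_) eq (s≤s (m≤n+m m d))
    K : ℕ
    K = ks (fromℕ< p) ∸ 2
    2+K≡k : 2 + K ≡ ks (fromℕ< p)
    2+K≡k = m+[n∸m]≡n (ks≥2 (fromℕ< p))
    last≡ : last (restrict (suc m) p ks) ≡ 2 + K
    last≡ = trans (restrict-last p) (sym 2+K≡k)
    init≤ : ∀ i → init (restrict (suc m) p ks) i ≤ 2 + K
    init≤ i = ≤-trans (restrict-init≤last p i) (≤-reflexive last≡)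
    q : ℕ
    q = prodFrom r ks (suc m)
    bound′ : suc L + (q + tailSum (suc m)) ≤ (2 + K) * q * suc N
    bound′ = subst₂ (λ s t → suc L + s ≤ t * suc N)
      (sumRange-step _ p) (trans (prodFrom-step ks p) (cong (_* q) (sym 2+K≡k))) bound

theorem2p2 : (r : ℕ) → 3 ≤ r → (ks : Fin r → ℕ)
    → ((i : Fin r) → 3 ≤ ks i)
    → ((i j : Fin r) → toℕ i ≤ toℕ j → ks i ≤ ks j)
    → (m : ℕ) → 2 ≤ m → (m<r : m < r)
    → (Sr Sm : ℕ)
    → IsSchurNumber r ks Sr
    → IsSchurNumber m (restrict m (<⇒≤ m<r) ks) Sm
    → prodFrom r ks m * Sm ≤ Sr + sumRange m r (λ i → prodFrom r ks (suc i))
theorem2p2 _ _ _ _ _ _ _ _ _ zero _ (() , _)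
theorem2p2 r _ ks ks≥3 ks-mono m 2≤m m<r Sr (suc N) (_ , schurR , _) isSm =
  decidable-stable (_ ≤? _) λ ≰ →
    IsSchurNumber⇒¬SchurProperty-pred {ks = restrict m (<⇒≤ m<r) ks} (≤-trans (s≤s z≤n) 2≤m) isSm
      (SchurProperty-restrict (r ∸ m) m (m∸n+n≡m (<⇒≤ m<r)) (<⇒≤ m<r) N Sr (≰⇒> ≰) schurR)
  where
  open Descent ks (λ i → ≤-trans (n≤1+n 2) (ks≥3 i)) ks-mono
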